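{- Let $p$ be a positive integer. Let $G$ be a bipartite graph with bipartition $(A,B)$, and let $d_A,d_B$ be the average degrees of the vertices in $A$ and in $B$, respectively. Suppose $d_A,d_B\geq 8p$. Then the number of paths of length $2p+1$ in $G$ is at least $\frac{1}{2^{6p+1}}\mathrm{e}(G)(d_Ad_B)^p$.
   Context: The length of a path is its number of edges; $\mathrm{e}(G)$ is the number of edges of $G$. -}

module Defs where

open import Data.Nat using (ℕ; zero; suc)
open import Data.Bool using (Bool; true; false; _∧_; not; if_then_else_)
open import Data.Fin using (Fin; _≟_)
open import Data.Vec using (Vec; []; _∷_)
open import Data.List using (List; [_]; map; concatMap; allFin; length; filterᵇ; cartesianProduct)
open import Data.Nat.ListAction using (sum)
open import Data.Product using (_×_; _,_)
open import Relation.Nullary.Decidable using (⌊_⌋)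

-- A finite simple bipartite graph with parts A = Fin m and B = Fin n,
-- given by its (bipartite) adjacency relation.
BipGraph : ℕ → ℕ → Set
BipGraph m n = Fin m → Fin n → Bool

edges : ∀ {m n} → BipGraph m n → ℕ
edges {m} {n} G = sum (map (λ a → sum (map (λ b → if G a b then 1 else 0) (allFin n))) (allFin m))

vecs : (k m : ℕ) → List (Vec (Fin m) k)
vecs zero    m = [ [] ]
vecs (suc k) m = concatMap (λ x → map (x ∷_) (vecs k m)) (allFin m)

notIn : ∀ {m k} → Fin m → Vec (Fin m) k → Bool
notIn x []       = true
notIn x (y ∷ ys) = not ⌊ x ≟ y ⌋ ∧ notIn x ys

distinct : ∀ {m k} → Vec (Fin m) k → Bool
distinct []       = true
distinct (x ∷ xs) = notIn x xs ∧ distinct xs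

alternatingWalk : ∀ {m n k} → BipGraph m n → Vec (Fin m) (suc k) → Vec (Fin n) (suc k) → Bool
alternatingWalk G (a ∷ [])      (b ∷ [])      = G a b
alternatingWalk G (a ∷ a' ∷ as) (b ∷ b' ∷ bs) = G a b ∧ G a' b ∧ alternatingWalk G (a' ∷ as) (b' ∷ bs)

isPath : ∀ {m n k} → BipGraph m n → Vec (Fin m) (suc k) × Vec (Fin n) (suc k) → Bool
isPath G (as , bs) = distinct as ∧ distinct bs ∧ alternatingWalk G as bs

-- Number of paths of length 2p+1 in G.  Such a path has one end in A and
-- one in B, so each path (as a subgraph) corresponds to exactly one vertex
-- sequence a₀ b₀ a₁ b₁ … a_p b_p starting in A.
numPaths : ∀ {m n} → BipGraph m n → (p : ℕ) → ℕ
numPaths {m} {n} G p = length (filterᵇ (isPath G) (cartesianProduct (vecs (suc p) m) (vecs (suc p) n)))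

module Submission where

-- Lemma 4.3: if the bipartite graph G on A = Fin m, B = Fin n has e = e(G) edges and average
-- degrees d_A = e/m ≥ 8p, d_B = e/n ≥ 8p, then G has at least e (d_A d_B)^p / 2^(6p+1) paths
-- of length 2p+1.  All statements are scaled so that only natural numbers occur.
--
-- Repeatedly delete a vertex a ∈ A with fewer than d_A/4
--    remaining neighbours, or b ∈ B with fewer than d_B/4.  Deleting such vertices costs fewer
--    than m·(d_A/4) + n·(d_B/4) = e/2 edges in total, which is tracked by a potential invariant.
--    The result is a subgraph H with e(H) ≥ e/2 in which both ends of every edge have degree at
--    least a quarter of the average degree of their side.
--  * Path extension (module Extension).  If every edge ab of H has deg a ≥ x_A + p and
--    deg b ≥ x_B + p, then a path a₀ b₀ … a_k b_k with k < p can be prepended by a pair (a, b)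
--    in at least x_A x_B ways: b ∉ {b₀…b_k} adjacent to a₀, then a ∉ {a₀…a_k} adjacent to b.
--    Inductively H has at least e(H) (x_A x_B)^p paths with p+1 vertices on each side.
-- With x_A = d_A/8 and x_B = d_B/8 this gives e/2 · (d_A d_B / 64)^p paths in H ⊆ G.

open import Data.Bool using (Bool; true; false; _∧_; not; if_then_else_)
import Data.Bool.Properties as Bool
open import Data.Bool.Properties using (∧-assoc; ∧-zeroʳ; ∧-conicalˡ; ∧-conicalʳ)
open import Data.Bool.Solver using (module ∨-∧-Solver)
open import Data.Fin using (Fin; _≟_) renaming (zero to fzero; suc to fsuc)
open import Data.Fin.Properties using (any?)
open import Data.List using (List; []; _∷_; map; concatMap; allFin; length; filterᵇ; cartesianProduct; _++_)
open import Data.List.Properties using (map-++; map-∘; map-tabulate)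
open import Data.Nat using (ℕ; zero; suc; _+_; _*_; _^_; _≤_; _<_; z≤n; s≤s; NonZero; _<?_)
open import Data.Nat.ListAction using (sum)
open import Data.Nat.ListAction.Properties using (sum-++)
open import Data.Nat.Properties hiding (_≟_)
open import Algebra.Properties.CommutativeSemigroup +-commutativeSemigroup
  using () renaming (interchange to +-interchange)
open import Algebra.Properties.CommutativeSemigroup *-commutativeSemigroup
  using () renaming (interchange to *-interchange; x∙yz≈y∙xz to *-left-swap)
open import Data.Nat.Tactic.RingSolver using (solve-∀)
open import Data.Product using (_×_; _,_; proj₁)
open import Data.Vec using (Vec; []; _∷_; head)
open import Function using (_∘_; id)
open import Relation.Binary.PropositionalEquality
open import Relation.Nullary using (Dec; yes; no; contradiction)
open import Relation.Nullary.Decidable using (⌊_⌋; _×-dec_)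

open import Defs

private
  variable
    A B : Set

[_]b : Bool → ℕ
[ b ]b = if b then 1 else 0

-- Finite sums over a list.  With this definition `edges G` is literally a double sum.
∑ : List A → (A → ℕ) → ℕ
∑ xs f = sum (map f xs)

syntax ∑ xs (λ x → t) = ∑[ x ← xs ] t

count : List A → (A → Bool) → ℕ
count xs P = ∑[ x ← xs ] [ P x ]b

indicator-∧ : ∀ x y → [ x ∧ y ]b ≡ [ x ]b * [ y ]b
indicator-∧ true  y = sym (+-identityʳ [ y ]b)
indicator-∧ false y = refl

indicator≤1 : ∀ x → [ x ]b ≤ 1
indicator≤1 true  = ≤-refl
indicator≤1 false = z≤n

∑-cong : (xs : List A) {f g : A → ℕ} → (∀ x → f x ≡ g x) → ∑ xs f ≡ ∑ xs g
∑-cong []       f≡g = refl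
∑-cong (x ∷ xs) f≡g = cong₂ _+_ (f≡g x) (∑-cong xs f≡g)

∑-mono : (xs : List A) {f g : A → ℕ} → (∀ x → f x ≤ g x) → ∑ xs f ≤ ∑ xs g
∑-mono []       f≤g = z≤n
∑-mono (x ∷ xs) f≤g = +-mono-≤ (f≤g x) (∑-mono xs f≤g)

∑-zero : (xs : List A) → ∑[ x ← xs ] 0 ≡ 0
∑-zero []       = refl
∑-zero (x ∷ xs) = ∑-zero xs

∑-+ : (xs : List A) (f g : A → ℕ) → ∑[ x ← xs ] (f x + g x) ≡ ∑ xs f + ∑ xs g
∑-+ []       f g = refl
∑-+ (x ∷ xs) f g =
  trans (cong (f x + g x +_) (∑-+ xs f g)) (+-interchange (f x) (g x) (∑ xs f) (∑ xs g))

∑-*ˡ : (xs : List A) (c : ℕ) (f : A → ℕ) → ∑[ x ← xs ] (c * f x) ≡ c * ∑ xs f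
∑-*ˡ []       c f = sym (*-zeroʳ c)
∑-*ˡ (x ∷ xs) c f = trans (cong (c * f x +_) (∑-*ˡ xs c f)) (sym (*-distribˡ-+ c (f x) (∑ xs f)))

∑-swap : (xs : List A) (ys : List B) (f : A → B → ℕ) →
         ∑[ x ← xs ] ∑[ y ← ys ] f x y ≡ ∑[ y ← ys ] ∑[ x ← xs ] f x y
∑-swap []       ys f = sym (∑-zero ys)
∑-swap (x ∷ xs) ys f =
  trans (cong (∑ ys (f x) +_) (∑-swap xs ys f)) (sym (∑-+ ys (f x) (λ y → ∑[ x′ ← xs ] f x′ y)))

∑-++ : (xs ys : List A) (f : A → ℕ) → ∑ (xs ++ ys) f ≡ ∑ xs f + ∑ ys f
∑-++ xs ys f = trans (cong sum (map-++ f xs ys)) (sum-++ (map f xs) (map f ys))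

∑-map : (g : B → A) (xs : List B) (f : A → ℕ) → ∑ (map g xs) f ≡ ∑ xs (f ∘ g)
∑-map g xs f = cong sum (sym (map-∘ xs))

∑-concatMap : (h : B → List A) (xs : List B) (f : A → ℕ) →
              ∑ (concatMap h xs) f ≡ ∑[ x ← xs ] ∑ (h x) f
∑-concatMap h []       f = refl
∑-concatMap h (x ∷ xs) f = trans (∑-++ (h x) (concatMap h xs) f) (cong (∑ (h x) f +_) (∑-concatMap h xs f))

∑-cartesianProduct : (xs : List A) (ys : List B) (f : A × B → ℕ) →
                     ∑ (cartesianProduct xs ys) f ≡ ∑[ x ← xs ] ∑[ y ← ys ] f (x , y)
∑-cartesianProduct []       ys f = refl
∑-cartesianProduct (x ∷ xs) ys f =
  trans (∑-++ (map (x ,_) ys) _ f) (cong₂ _+_ (∑-map (x ,_) ys f) (∑-cartesianProduct xs ys f))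

∑-vecs : ∀ k m (f : Vec (Fin m) (suc k) → ℕ) →
         ∑ (vecs (suc k) m) f ≡ ∑[ x ← allFin m ] ∑[ v ← vecs k m ] f (x ∷ v)
∑-vecs k m f = trans (∑-concatMap _ (allFin m) f) (∑-cong (allFin m) (λ x → ∑-map (x ∷_) (vecs k m) f))

length-filterᵇ : (P : A → Bool) (xs : List A) → length (filterᵇ P xs) ≡ count xs P
length-filterᵇ P []       = refl
length-filterᵇ P (x ∷ xs) with P x
... | true  = cong suc (length-filterᵇ P xs)
... | false = length-filterᵇ P xs

count-mono : (xs : List A) {P Q : A → Bool} → (∀ x → P x ≡ true → Q x ≡ true) → count xs P ≤ count xs Q
count-mono xs P⇒Q = ∑-mono xs (λ x → indicator-mono (P⇒Q x))
  where
  indicator-mono : ∀ {x y} → (x ≡ true → y ≡ true) → [ x ]b ≤ [ y ]b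
  indicator-mono {false} f = z≤n
  indicator-mono {true}  f rewrite f refl = ≤-refl

∑-scale-mono : (xs : List A) (c d : ℕ) {f g : A → ℕ} → (∀ x → c * f x ≤ d * g x) → c * ∑ xs f ≤ d * ∑ xs g
∑-scale-mono xs c d {f} {g} h = begin
  c * ∑ xs f             ≡⟨ ∑-*ˡ xs c f ⟨
  ∑[ x ← xs ] (c * f x)  ≤⟨ ∑-mono xs h ⟩
  ∑[ x ← xs ] (d * g x)  ≡⟨ ∑-*ˡ xs d g ⟩
  d * ∑ xs g             ∎
  where open ≤-Reasoning

count-weighted : (xs : List A) (P : A → Bool) {c : ℕ} (g : A → ℕ) →
                 (∀ x → P x ≡ true → c ≤ g x) → c * count xs P ≤ ∑[ x ← xs ] ([ P x ]b * g x)
count-weighted xs P {c} g large = ≤-trans (≤-reflexive (sym (∑-*ˡ xs c _))) (∑-mono xs (λ x → scale (P x) (large x)))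
  where
  scale : ∀ b {y} → (b ≡ true → c ≤ y) → c * [ b ]b ≤ [ b ]b * y
  scale true  {y} h = ≤-trans (≤-reflexive (*-identityʳ c)) (≤-trans (h refl) (≤-reflexive (sym (+-identityʳ y))))
  scale false     h = ≤-reflexive (*-zeroʳ c)

∑-allFin-suc : ∀ k (f : Fin (suc k) → ℕ) → ∑ (allFin (suc k)) f ≡ f fzero + ∑[ x ← allFin k ] f (fsuc x)
∑-allFin-suc k f = cong (λ xs → f fzero + sum xs) (trans (map-tabulate fsuc f) (sym (map-tabulate id (f ∘ fsuc))))

fsuc-≟ : ∀ {k} (x a : Fin k) → ⌊ fsuc x ≟ fsuc a ⌋ ≡ ⌊ x ≟ a ⌋
fsuc-≟ x a with x ≟ a
... | yes _ = refl
... | no  _ = refl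

∑-pick : ∀ {k} (a : Fin k) (f : Fin k → ℕ) →
         ∑ (allFin k) f ≡ ∑[ x ← allFin k ] (if ⌊ x ≟ a ⌋ then 0 else f x) + f a
∑-pick {suc k} fzero f = begin
  ∑ (allFin (suc k)) f                    ≡⟨ ∑-allFin-suc k f ⟩
  f fzero + ∑[ x ← allFin k ] f (fsuc x)  ≡⟨ +-comm (f fzero) _ ⟩
  ∑[ x ← allFin k ] f (fsuc x) + f fzero  ≡⟨ cong (_+ f fzero) (∑-allFin-suc k (λ x → if ⌊ x ≟ fzero ⌋ then 0 else f x)) ⟨
  ∑[ x ← allFin (suc k) ] (if ⌊ x ≟ fzero ⌋ then 0 else f x) + f fzero ∎
  where open ≡-Reasoning
∑-pick {suc k} (fsuc a) f = begin
  ∑ (allFin (suc k)) f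
    ≡⟨ ∑-allFin-suc k f ⟩
  f fzero + ∑[ x ← allFin k ] f (fsuc x)
    ≡⟨ cong (f fzero +_) (∑-pick a (f ∘ fsuc)) ⟩
  f fzero + (∑[ x ← allFin k ] (if ⌊ x ≟ a ⌋ then 0 else f (fsuc x)) + f (fsuc a))
    ≡⟨ +-assoc (f fzero) _ _ ⟨
  f fzero + ∑[ x ← allFin k ] (if ⌊ x ≟ a ⌋ then 0 else f (fsuc x)) + f (fsuc a)
    ≡⟨ cong (λ t → f fzero + t + f (fsuc a))
            (∑-cong (allFin k) (λ x → cong (if_then 0 else f (fsuc x)) (sym (fsuc-≟ x a)))) ⟩
  f fzero + ∑[ x ← allFin k ] (if ⌊ fsuc x ≟ fsuc a ⌋ then 0 else f (fsuc x)) + f (fsuc a)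
    ≡⟨ cong (_+ f (fsuc a)) (∑-allFin-suc k (λ x → if ⌊ x ≟ fsuc a ⌋ then 0 else f x)) ⟨
  ∑[ x ← allFin (suc k) ] (if ⌊ x ≟ fsuc a ⌋ then 0 else f x) + f (fsuc a) ∎
  where open ≡-Reasoning

VertexSet : ℕ → Set
VertexSet k = Fin k → Bool

size : ∀ {k} → VertexSet k → ℕ
size {k} S = count (allFin k) S

full : ∀ {k} → VertexSet k
full _ = true

_─_ : ∀ {k} → VertexSet k → Fin k → VertexSet k
(S ─ a) x = not ⌊ x ≟ a ⌋ ∧ S x

size-full : ∀ k → size {k} full ≡ k
size-full zero    = refl
size-full (suc k) = trans (∑-allFin-suc k (λ _ → 1)) (cong suc (size-full k))

size-─ : ∀ {k} (S : VertexSet k) (a : Fin k) → size S ≡ size (S ─ a) + [ S a ]b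
size-─ {k} S a = trans (∑-pick a (λ x → [ S x ]b)) (cong (_+ [ S a ]b) (∑-cong (allFin k) (λ x → drop ⌊ x ≟ a ⌋ (S x))))
  where
  drop : ∀ d s → (if d then 0 else [ s ]b) ≡ [ not d ∧ s ]b
  drop true  s = refl
  drop false s = refl

size-─1 : ∀ {k} (S : VertexSet k) {a : Fin k} → S a ≡ true → size S ≡ suc (size (S ─ a))
size-─1 S {a} Sa = trans (size-─ S a) (trans (cong (λ b → size (S ─ a) + [ b ]b) Sa) (+-comm _ 1))

size-─< : ∀ {k} (S : VertexSet k) {a : Fin k} → S a ≡ true → size (S ─ a) < size S
size-─< S Sa = ≤-reflexive (sym (size-─1 S Sa))

count-avoid : ∀ {q j} (vs : Vec (Fin q) j) (P : VertexSet q) → size P ≤ size (λ x → notIn x vs ∧ P x) + j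
count-avoid         []       P = m≤m+n (size P) 0
count-avoid {q} {suc j} (y ∷ ys) P = begin
  size P                                      ≤⟨ count-avoid ys P ⟩
  size S + j                                  ≡⟨ cong (_+ j) (size-─ S y) ⟩
  size (S ─ y) + [ S y ]b + j                 ≤⟨ +-monoˡ-≤ j (+-monoʳ-≤ (size (S ─ y)) (indicator≤1 (S y))) ⟩
  size (S ─ y) + 1 + j                        ≡⟨ +-assoc (size (S ─ y)) 1 j ⟩
  size (S ─ y) + suc j                        ≡⟨ cong (_+ suc j) (∑-cong (allFin q) (λ x → cong [_]b (sym (∧-assoc (not ⌊ x ≟ y ⌋) _ _)))) ⟩
  size (λ x → notIn x (y ∷ ys) ∧ P x) + suc j ∎
  where
  open ≤-Reasoning
  S : VertexSet q
  S x = notIn x ys ∧ P x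

module _ {m n : ℕ} where

  degA : BipGraph m n → Fin m → ℕ
  degA G a = count (allFin n) (G a)

  degB : BipGraph m n → Fin n → ℕ
  degB G b = count (allFin m) (λ a → G a b)

  induced : BipGraph m n → VertexSet m → VertexSet n → BipGraph m n
  induced G SA SB a b = SA a ∧ (SB b ∧ G a b)

  edges-─A : (G : BipGraph m n) (SA : VertexSet m) (SB : VertexSet n) (a : Fin m) →
             edges (induced G SA SB) ≡ edges (induced G (SA ─ a) SB) + degA (induced G SA SB) a
  edges-─A G SA SB a = trans (∑-pick a (degA H)) (cong (_+ degA H a) (∑-cong (allFin m) row))
    where
    H = induced G SA SB
    row : ∀ x → (if ⌊ x ≟ a ⌋ then 0 else degA H x) ≡ degA (induced G (SA ─ a) SB) x
    row x with ⌊ x ≟ a ⌋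
    ... | true  = sym (∑-zero (allFin n))
    ... | false = refl

  edges-─B : (G : BipGraph m n) (SA : VertexSet m) (SB : VertexSet n) (b : Fin n) →
             edges (induced G SA SB) ≡ edges (induced G SA (SB ─ b)) + degB (induced G SA SB) b
  edges-─B G SA SB b = trans (∑-cong (allFin m) row) (∑-+ (allFin m) (degA H′) (λ x → [ H x b ]b))
    where
    H  = induced G SA SB
    H′ = induced G SA (SB ─ b)
    entry : ∀ x y → (if ⌊ y ≟ b ⌋ then 0 else [ H x y ]b) ≡ [ H′ x y ]b
    entry x y with ⌊ y ≟ b ⌋
    ... | true  = cong [_]b (sym (∧-zeroʳ (SA x)))
    ... | false = refl
    row : ∀ x → degA H x ≡ degA H′ x + [ H x b ]b
    row x = trans (∑-pick b (λ y → [ H x y ]b)) (cong (_+ [ H x b ]b) (∑-cong (allFin n) (entry x)))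

-- A dense core of G: a subgraph keeping at least half of the e = e(G) edges in which both ends of
-- every edge have at least a quarter of the average degree of their side, deg a ≥ e/4m and
-- deg b ≥ e/4n.
record Core {m n : ℕ} (G : BipGraph m n) : Set where
  field
    H     : BipGraph m n
    H⊆G   : ∀ a b → H a b ≡ true → G a b ≡ true
    half  : edges G ≤ 2 * edges H
    highA : ∀ a b → H a b ≡ true → edges G ≤ 4 * m * degA H a
    highB : ∀ a b → H a b ≡ true → edges G ≤ 4 * n * degB H b

discharge : ∀ K W′ {w X′ x} → x ≤ w → K + (W′ + w) ≤ X′ + x → K + W′ ≤ X′
discharge K W′ {w} {X′} {x} x≤w bound = +-cancelʳ-≤ w (K + W′) X′ (begin
  K + W′ + w   ≡⟨ +-assoc K W′ w ⟩
  K + (W′ + w) ≤⟨ bound ⟩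
  X′ + x       ≤⟨ +-monoʳ-≤ X′ x≤w ⟩
  X′ + w       ∎)
  where open ≤-Reasoning

module Cleaning {m n : ℕ} .{{_ : NonZero m}} .{{_ : NonZero n}} (G : BipGraph m n) where

  e : ℕ
  e = edges G

  sub : VertexSet m → VertexSet n → BipGraph m n
  sub = induced G

  -- e(H) ≥ e/2 + (e/4m)·|SA| + (e/4n)·|SB|, multiplied by 4mn.  It holds with equality for
  -- H = G and only gets easier as vertices are deleted, so at the end e(H) ≥ e/2.
  Invariant : VertexSet m → VertexSet n → Set
  Invariant SA SB = 2 * (m * n) * e + (n * e * size SA + m * e * size SB) ≤ 4 * (m * n) * edges (sub SA SB)

  LowA : VertexSet m → VertexSet n → Fin m → Set
  LowA SA SB a = SA a ≡ true × 4 * m * degA (sub SA SB) a < e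

  LowB : VertexSet m → VertexSet n → Fin n → Set
  LowB SA SB b = SB b ≡ true × 4 * n * degB (sub SA SB) b < e

  lowA? : ∀ SA SB a → Dec (LowA SA SB a)
  lowA? SA SB a = (SA a Bool.≟ true) ×-dec (4 * m * degA (sub SA SB) a <? e)

  lowB? : ∀ SA SB b → Dec (LowB SA SB b)
  lowB? SA SB b = (SB b Bool.≟ true) ×-dec (4 * n * degB (sub SA SB) b <? e)

  initial : Invariant full full
  initial = ≤-reflexive (begin
    2 * (m * n) * e + (n * e * size {m} full + m * e * size {n} full)
      ≡⟨ cong₂ (λ s t → 2 * (m * n) * e + (n * e * s + m * e * t)) (size-full m) (size-full n) ⟩
    2 * (m * n) * e + (n * e * m + m * e * n)
      ≡⟨ total m n e ⟩
    4 * (m * n) * e ∎)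
    where
    open ≡-Reasoning
    total : ∀ m n e → 2 * (m * n) * e + (n * e * m + m * e * n) ≡ 4 * (m * n) * e
    total = solve-∀

  -- Deleting a low vertex a lowers the weight by n·e and 4mn·e(H) by 4mn·deg a < n·e.
  removeA : ∀ {SA SB a} → LowA SA SB a → Invariant SA SB → Invariant (SA ─ a) SB
  removeA {SA} {SB} {a} (SAa , low) inv =
    discharge (2 * (m * n) * e) (n * e * size (SA ─ a) + m * e * size SB) lost (begin
      2 * (m * n) * e + (n * e * size (SA ─ a) + m * e * size SB + n * e)
        ≡⟨ cong (2 * (m * n) * e +_) (trans (shift (n * e) (size (SA ─ a)) (m * e * size SB))
                                              (cong (λ s → n * e * s + m * e * size SB) (sym (size-─1 SA SAa)))) ⟩
      2 * (m * n) * e + (n * e * size SA + m * e * size SB)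
        ≤⟨ inv ⟩
      4 * (m * n) * edges (sub SA SB)
        ≡⟨ trans (cong (4 * (m * n) *_) (edges-─A G SA SB a)) (*-distribˡ-+ (4 * (m * n)) _ _) ⟩
      4 * (m * n) * edges (sub (SA ─ a) SB) + 4 * (m * n) * degA (sub SA SB) a ∎)
    where
    open ≤-Reasoning
    shift : ∀ c s t → c * s + t + c ≡ c * (1 + s) + t
    shift = solve-∀
    rearrange : ∀ m n d → 4 * (m * n) * d ≡ n * (4 * m * d)
    rearrange = solve-∀
    lost : 4 * (m * n) * degA (sub SA SB) a ≤ n * e
    lost = ≤-trans (≤-reflexive (rearrange m n _)) (*-monoʳ-≤ n (<⇒≤ low))

  removeB : ∀ {SA SB b} → LowB SA SB b → Invariant SA SB → Invariant SA (SB ─ b)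
  removeB {SA} {SB} {b} (SBb , low) inv =
    discharge (2 * (m * n) * e) (n * e * size SA + m * e * size (SB ─ b)) lost (begin
      2 * (m * n) * e + (n * e * size SA + m * e * size (SB ─ b) + m * e)
        ≡⟨ cong (2 * (m * n) * e +_) (trans (shift (m * e) (size (SB ─ b)) (n * e * size SA))
                                              (cong (λ s → n * e * size SA + m * e * s) (sym (size-─1 SB SBb)))) ⟩
      2 * (m * n) * e + (n * e * size SA + m * e * size SB)
        ≤⟨ inv ⟩
      4 * (m * n) * edges (sub SA SB)
        ≡⟨ trans (cong (4 * (m * n) *_) (edges-─B G SA SB b)) (*-distribˡ-+ (4 * (m * n)) _ _) ⟩
      4 * (m * n) * edges (sub SA (SB ─ b)) + 4 * (m * n) * degB (sub SA SB) b ∎)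
    where
    open ≤-Reasoning
    shift : ∀ c s t → t + c * s + c ≡ t + c * (1 + s)
    shift = solve-∀
    rearrange : ∀ m n d → 4 * (m * n) * d ≡ m * (4 * n * d)
    rearrange = solve-∀
    lost : 4 * (m * n) * degB (sub SA SB) b ≤ m * e
    lost = ≤-trans (≤-reflexive (rearrange m n _)) (*-monoʳ-≤ m (<⇒≤ low))

  half : ∀ {SA SB} → Invariant SA SB → e ≤ 2 * edges (sub SA SB)
  half {SA} {SB} inv = *-cancelˡ-≤ (2 * (m * n)) {{m*n≢0 2 (m * n) {{_}} {{m*n≢0 m n}}}} (begin
    2 * (m * n) * e                                        ≤⟨ m≤m+n _ _ ⟩
    2 * (m * n) * e + (n * e * size SA + m * e * size SB)  ≤⟨ inv ⟩
    4 * (m * n) * edges (sub SA SB)                        ≡⟨ double (m * n) _ ⟩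
    2 * (m * n) * (2 * edges (sub SA SB))                  ∎)
    where
    open ≤-Reasoning
    double : ∀ k E → 4 * k * E ≡ 2 * k * (2 * E)
    double = solve-∀

  -- Delete low vertices while there are any; every deletion shrinks |SA| + |SB| < fuel.
  clean : ∀ fuel SA SB → size SA + size SB < fuel → Invariant SA SB → Core G
  clean zero SA SB () inv
  clean (suc fuel) SA SB bound inv with any? (lowA? SA SB) | any? (lowB? SA SB)
  ... | yes (a , low) | _ =
    clean fuel (SA ─ a) SB (<-≤-trans (+-monoˡ-< (size SB) (size-─< SA (proj₁ low))) (≤-pred bound)) (removeA low inv)
  ... | no _ | yes (b , low) =
    clean fuel SA (SB ─ b) (<-≤-trans (+-monoʳ-< (size SA) (size-─< SB (proj₁ low))) (≤-pred bound)) (removeB low inv)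
  ... | no noLowA | no noLowB = record
    { H     = sub SA SB
    ; H⊆G   = λ a b h → ∧-conicalʳ (SB b) (G a b) (∧-conicalʳ (SA a) _ h)
    ; half  = half inv
    ; highA = highA
    ; highB = highB
    }
    where
    highA : ∀ a b → sub SA SB a b ≡ true → e ≤ 4 * m * degA (sub SA SB) a
    highA a b h with 4 * m * degA (sub SA SB) a <? e
    ... | yes low = contradiction (a , ∧-conicalˡ (SA a) _ h , low) noLowA
    ... | no ¬low = ≮⇒≥ ¬low
    highB : ∀ a b → sub SA SB a b ≡ true → e ≤ 4 * n * degB (sub SA SB) b
    highB a b h with 4 * n * degB (sub SA SB) b <? e
    ... | yes low = contradiction (b , ∧-conicalˡ (SB b) _ (∧-conicalʳ (SA a) _ h) , low) noLowB
    ... | no ¬low = ≮⇒≥ ¬low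

  core : Core G
  core = clean (suc (m + n)) full full (s≤s (≤-reflexive (cong₂ _+_ (size-full m) (size-full n)))) initial

∧-mono : ∀ {x x′ y y′} → (x ≡ true → x′ ≡ true) → (y ≡ true → y′ ≡ true) → x ∧ y ≡ true → x′ ∧ y′ ≡ true
∧-mono {true} {true}  f g h = g h
∧-mono {true} {false} f g h = f refl

module _ {m n : ℕ} where

  path-head : ∀ {k} (H : BipGraph m n) {a b} (as : Vec (Fin m) k) (bs : Vec (Fin n) k) →
              isPath H (a ∷ as , b ∷ bs) ≡ true → H a b ≡ true
  path-head H []       []       h = h
  path-head H {a} {b} (a′ ∷ as) (b′ ∷ bs) h =
    ∧-conicalˡ _ _ (∧-conicalʳ (distinct (b ∷ b′ ∷ bs)) _ (∧-conicalʳ (distinct (a ∷ a′ ∷ as)) _ h))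

  walk-mono : ∀ {k} {H G : BipGraph m n} → (∀ a b → H a b ≡ true → G a b ≡ true) →
              (as : Vec (Fin m) (suc k)) (bs : Vec (Fin n) (suc k)) →
              alternatingWalk H as bs ≡ true → alternatingWalk G as bs ≡ true
  walk-mono H⊆G (a ∷ [])      (b ∷ [])      = H⊆G a b
  walk-mono H⊆G (a ∷ a′ ∷ as) (b ∷ b′ ∷ bs) =
    ∧-mono (H⊆G a b) (∧-mono (H⊆G a′ b) (walk-mono H⊆G (a′ ∷ as) (b′ ∷ bs)))

  path-mono : ∀ {k} {H G : BipGraph m n} → (∀ a b → H a b ≡ true → G a b ≡ true) →
              (x : Vec (Fin m) (suc k) × Vec (Fin n) (suc k)) → isPath H x ≡ true → isPath G x ≡ true
  path-mono H⊆G (as , bs) = ∧-mono {distinct as} id (∧-mono {distinct bs} id (walk-mono H⊆G as bs))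

  numPaths-mono : {H G : BipGraph m n} → (∀ a b → H a b ≡ true → G a b ≡ true) → ∀ p → numPaths H p ≤ numPaths G p
  numPaths-mono {H} {G} H⊆G p = begin
    numPaths H p ≡⟨ length-filterᵇ (isPath H) pairs ⟩
    count pairs (isPath H) ≤⟨ count-mono pairs (path-mono H⊆G) ⟩
    count pairs (isPath G) ≡⟨ length-filterᵇ (isPath G) pairs ⟨
    numPaths G p ∎
    where
    open ≤-Reasoning
    pairs = cartesianProduct (vecs (suc p) m) (vecs (suc p) n)

  extend-path : ∀ {k} (H : BipGraph m n) (a : Fin m) (b : Fin n) (as : Vec (Fin m) (suc k)) (bs : Vec (Fin n) (suc k)) →
                isPath H (as , bs) ≡ true →
                isPath H (a ∷ as , b ∷ bs) ≡ (notIn b bs ∧ H (head as) b) ∧ (notIn a as ∧ H a b)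
  extend-path H a b (a₀ ∷ as) (b₀ ∷ bs) =
    rearrange (notIn a (a₀ ∷ as)) (notIn b (b₀ ∷ bs)) (H a b) (H a₀ b)
              (distinct (a₀ ∷ as)) (distinct (b₀ ∷ bs)) (alternatingWalk H (a₀ ∷ as) (b₀ ∷ bs))
    where
    open ∨-∧-Solver
    rearrange : ∀ w x y z u v t → u ∧ (v ∧ t) ≡ true →
                (w ∧ u) ∧ ((x ∧ v) ∧ (y ∧ (z ∧ t))) ≡ (x ∧ z) ∧ (w ∧ y)
    rearrange w x y z true true true refl =
      solve 4 (λ w x y z → (w :* con true) :* ((x :* con true) :* (y :* (z :* con true)))
                           := (x :* z) :* (w :* y)) refl w x y z

  extensions : ∀ {k} → BipGraph m n → Vec (Fin m) k → Vec (Fin n) k → ℕ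
  extensions H as bs = ∑[ b ← allFin n ] ∑[ a ← allFin m ] [ isPath H (a ∷ as , b ∷ bs) ]b

  -- Paths counted as a double sum; those with one vertex per side are the edges, and every
  -- longer path is uniquely an extension of the path obtained by dropping its first pair.
  numPaths-∑ : (H : BipGraph m n) (k : ℕ) →
               numPaths H k ≡ ∑[ as ← vecs (suc k) m ] ∑[ bs ← vecs (suc k) n ] [ isPath H (as , bs) ]b
  numPaths-∑ H k = trans (length-filterᵇ (isPath H) (cartesianProduct (vecs (suc k) m) (vecs (suc k) n)))
                         (∑-cartesianProduct (vecs (suc k) m) (vecs (suc k) n) (λ x → [ isPath H x ]b))

  numPaths-zero : (H : BipGraph m n) → numPaths H 0 ≡ edges H
  numPaths-zero H = trans (numPaths-∑ H 0) (trans (∑-vecs 0 m _) (∑-cong (allFin m) λ a →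
    trans (+-identityʳ _) (trans (∑-vecs 0 n _) (∑-cong (allFin n) λ b → +-identityʳ _))))

  numPaths-suc : (H : BipGraph m n) (k : ℕ) →
                 numPaths H (suc k) ≡ ∑[ as ← vecs (suc k) m ] ∑[ bs ← vecs (suc k) n ] extensions H as bs
  numPaths-suc H k = begin
    numPaths H (suc k)
      ≡⟨ numPaths-∑ H (suc k) ⟩
    ∑[ as′ ← vecs (suc (suc k)) m ] ∑[ bs′ ← vecs (suc (suc k)) n ] P as′ bs′
      ≡⟨ ∑-vecs (suc k) m _ ⟩
    ∑[ a ← allFin m ] ∑[ as ← vecs (suc k) m ] ∑[ bs′ ← vecs (suc (suc k)) n ] P (a ∷ as) bs′
      ≡⟨ ∑-cong (allFin m) (λ a → ∑-cong (vecs (suc k) m) (λ as → ∑-vecs (suc k) n _)) ⟩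
    ∑[ a ← allFin m ] ∑[ as ← vecs (suc k) m ] ∑[ b ← allFin n ] ∑[ bs ← vecs (suc k) n ] P (a ∷ as) (b ∷ bs)
      ≡⟨ ∑-swap (allFin m) (vecs (suc k) m) _ ⟩
    ∑[ as ← vecs (suc k) m ] ∑[ a ← allFin m ] ∑[ b ← allFin n ] ∑[ bs ← vecs (suc k) n ] P (a ∷ as) (b ∷ bs)
      ≡⟨ ∑-cong (vecs (suc k) m) (λ as → inner as) ⟩
    ∑[ as ← vecs (suc k) m ] ∑[ bs ← vecs (suc k) n ] extensions H as bs ∎
    where
    open ≡-Reasoning
    P : Vec (Fin m) (suc (suc k)) → Vec (Fin n) (suc (suc k)) → ℕ
    P as bs = [ isPath H (as , bs) ]b
    inner : ∀ as → ∑[ a ← allFin m ] ∑[ b ← allFin n ] ∑[ bs ← vecs (suc k) n ] P (a ∷ as) (b ∷ bs)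
                 ≡ ∑[ bs ← vecs (suc k) n ] extensions H as bs
    inner as = begin
      ∑[ a ← allFin m ] ∑[ b ← allFin n ] ∑[ bs ← vecs (suc k) n ] P (a ∷ as) (b ∷ bs)
        ≡⟨ ∑-cong (allFin m) (λ a → ∑-swap (allFin n) (vecs (suc k) n) _) ⟩
      ∑[ a ← allFin m ] ∑[ bs ← vecs (suc k) n ] ∑[ b ← allFin n ] P (a ∷ as) (b ∷ bs)
        ≡⟨ ∑-swap (allFin m) (vecs (suc k) n) _ ⟩
      ∑[ bs ← vecs (suc k) n ] ∑[ a ← allFin m ] ∑[ b ← allFin n ] P (a ∷ as) (b ∷ bs)
        ≡⟨ ∑-cong (vecs (suc k) n) (λ bs → ∑-swap (allFin m) (allFin n) _) ⟩
      ∑[ bs ← vecs (suc k) n ] extensions H as bs ∎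

enough-left : ∀ q {x p d c j} → x + q * p ≤ q * d → d ≤ c + j → j ≤ p → x ≤ q * c
enough-left q {x} {p} {d} {c} {j} large d≤c+j j≤p = +-cancelʳ-≤ (q * p) x (q * c) (begin
  x + q * p     ≤⟨ large ⟩
  q * d         ≤⟨ *-monoʳ-≤ q d≤c+j ⟩
  q * (c + j)   ≡⟨ *-distribˡ-+ q c j ⟩
  q * c + q * j ≤⟨ +-monoʳ-≤ (q * c) (*-monoʳ-≤ q j≤p) ⟩
  q * c + q * p ∎)
  where open ≤-Reasoning

module Extension {m n : ℕ} (H : BipGraph m n) (p xA qA xB qB : ℕ)
  (largeA : ∀ a b → H a b ≡ true → xA + qA * p ≤ qA * degA H a)
  (largeB : ∀ a b → H a b ≡ true → xB + qB * p ≤ qB * degB H b) where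

  -- A path with k+1 ≤ p vertices per side has at least (xA/qA)(xB/qB) extensions: the newB
  -- choices of b, and for each of them the newA b choices of a.
  extensions-lower : ∀ {k} → k < p → (as : Vec (Fin m) (suc k)) (bs : Vec (Fin n) (suc k)) →
                     xA * xB * [ isPath H (as , bs) ]b ≤ qA * qB * extensions H as bs
  extensions-lower {k} k<p as@(a₀ ∷ as′) bs@(b₀ ∷ bs′) with isPath H (as , bs) in path
  ... | false = ≤-trans (≤-reflexive (*-zeroʳ (xA * xB))) z≤n
  ... | true  = begin
    xA * xB * 1                                    ≡⟨ *-identityʳ (xA * xB) ⟩
    xA * xB                                        ≤⟨ *-monoˡ-≤ xB choicesB ⟩
    qA * size newB * xB                            ≡⟨ trans (*-assoc qA _ xB) (cong (qA *_) (*-comm (size newB) xB)) ⟩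
    qA * (xB * size newB)                          ≤⟨ *-monoʳ-≤ qA (count-weighted (allFin n) newB _ choicesA) ⟩
    qA * ∑[ b ← allFin n ] ([ newB b ]b * (qB * size (newA b)))
      ≡⟨ cong (qA *_) (trans (∑-cong (allFin n) (λ b → *-left-swap [ newB b ]b qB _)) (∑-*ˡ (allFin n) qB _)) ⟩
    qA * (qB * ∑[ b ← allFin n ] ([ newB b ]b * size (newA b)))
      ≡⟨ sym (*-assoc qA qB _) ⟩
    qA * qB * ∑[ b ← allFin n ] ([ newB b ]b * size (newA b))
      ≡⟨ cong (qA * qB *_) (sym split) ⟩
    qA * qB * extensions H as bs ∎
    where
    open ≤-Reasoning
    newB : VertexSet n
    newB b = notIn b bs ∧ H a₀ b
    newA : Fin n → VertexSet m
    newA b a = notIn a as ∧ H a b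
    split : extensions H as bs ≡ ∑[ b ← allFin n ] ([ newB b ]b * size (newA b))
    split = ∑-cong (allFin n) λ b →
      trans (∑-cong (allFin m) (λ a → trans (cong [_]b (extend-path H a b as bs path)) (indicator-∧ (newB b) (newA b a))))
            (∑-*ˡ (allFin m) [ newB b ]b (λ a → [ newA b a ]b))
    choicesB : xA ≤ qA * size newB
    choicesB = enough-left qA (largeA a₀ b₀ (path-head H as′ bs′ path))
                           (count-avoid bs (H a₀)) k<p
    choicesA : ∀ b → newB b ≡ true → xB ≤ qB * size (newA b)
    choicesA b new = enough-left qB (largeB a₀ b (∧-conicalʳ _ _ new)) (count-avoid as (λ a → H a b)) k<p

  growth : ∀ {k} → k < p → xA * xB * numPaths H k ≤ qA * qB * numPaths H (suc k)
  growth {k} k<p = begin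
    xA * xB * numPaths H k
      ≡⟨ cong (xA * xB *_) (numPaths-∑ H k) ⟩
    xA * xB * ∑[ as ← vecs (suc k) m ] ∑[ bs ← vecs (suc k) n ] [ isPath H (as , bs) ]b
      ≤⟨ ∑-scale-mono (vecs (suc k) m) (xA * xB) (qA * qB) (λ as →
           ∑-scale-mono (vecs (suc k) n) (xA * xB) (qA * qB) (extensions-lower k<p as)) ⟩
    qA * qB * ∑[ as ← vecs (suc k) m ] ∑[ bs ← vecs (suc k) n ] extensions H as bs
      ≡⟨ cong (qA * qB *_) (numPaths-suc H k) ⟨
    qA * qB * numPaths H (suc k) ∎
    where open ≤-Reasoning

  many-paths : ∀ k → k ≤ p → edges H * (xA * xB) ^ k ≤ (qA * qB) ^ k * numPaths H k
  many-paths zero    _   = ≤-reflexive (trans (*-identityʳ (edges H)) (trans (sym (numPaths-zero H)) (sym (+-identityʳ _))))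
  many-paths (suc k) k<p = begin
    edges H * (xA * xB * (xA * xB) ^ k)      ≡⟨ *-left-swap (edges H) (xA * xB) _ ⟩
    xA * xB * (edges H * (xA * xB) ^ k)      ≤⟨ *-monoʳ-≤ (xA * xB) (many-paths k (<⇒≤ k<p)) ⟩
    xA * xB * ((qA * qB) ^ k * numPaths H k) ≡⟨ *-left-swap (xA * xB) ((qA * qB) ^ k) _ ⟩
    (qA * qB) ^ k * (xA * xB * numPaths H k) ≤⟨ *-monoʳ-≤ ((qA * qB) ^ k) (growth k<p) ⟩
    (qA * qB) ^ k * (qA * qB * numPaths H (suc k))
      ≡⟨ trans (*-left-swap ((qA * qB) ^ k) (qA * qB) _) (sym (*-assoc (qA * qB) _ _)) ⟩
    qA * qB * (qA * qB) ^ k * numPaths H (suc k) ∎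
    where open ≤-Reasoning

margin : ∀ q {e p d} → 8 * p * q ≤ e → e ≤ 4 * q * d → e + 8 * q * p ≤ 8 * q * d
margin q {e} {p} {d} dense high = begin
  e + 8 * q * p       ≡⟨ cong (e +_) (swap q p) ⟩
  e + 8 * p * q       ≤⟨ +-monoʳ-≤ e dense ⟩
  e + e               ≤⟨ +-mono-≤ high high ⟩
  4 * q * d + 4 * q * d ≡⟨ double q d ⟩
  8 * q * d           ∎
  where
  open ≤-Reasoning
  swap : ∀ q p → 8 * q * p ≡ 8 * p * q
  swap = solve-∀
  double : ∀ q d → 4 * q * d + 4 * q * d ≡ 8 * q * d
  double = solve-∀

^-distribʳ-* : ∀ a b k → (a * b) ^ k ≡ a ^ k * b ^ k
^-distribʳ-* a b zero    = refl
^-distribʳ-* a b (suc k) = trans (cong (a * b *_) (^-distribʳ-* a b k)) (*-interchange a b (a ^ k) (b ^ k))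

constant : ∀ p m n N → 2 * ((8 * m * (8 * n)) ^ p * N) ≡ 2 ^ (6 * p + 1) * (m * n) ^ p * N
constant p m n N = begin
  2 * ((8 * m * (8 * n)) ^ p * N)      ≡⟨ cong (λ t → 2 * (t ^ p * N)) (sixty-four m n) ⟩
  2 * ((2 ^ 6 * (m * n)) ^ p * N)      ≡⟨ cong (λ t → 2 * (t * N)) (^-distribʳ-* (2 ^ 6) (m * n) p) ⟩
  2 * ((2 ^ 6) ^ p * (m * n) ^ p * N)  ≡⟨ cong (λ t → 2 * (t * (m * n) ^ p * N)) (^-*-assoc 2 6 p) ⟩
  2 * (2 ^ (6 * p) * (m * n) ^ p * N)  ≡⟨ reorder 2 (2 ^ (6 * p)) ((m * n) ^ p) N ⟩
  2 ^ (6 * p) * 2 * (m * n) ^ p * N    ≡⟨ cong (λ t → t * (m * n) ^ p * N) (^-distribˡ-+-* 2 (6 * p) 1) ⟨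
  2 ^ (6 * p + 1) * (m * n) ^ p * N    ∎
  where
  open ≡-Reasoning
  sixty-four : ∀ m n → 8 * m * (8 * n) ≡ 2 ^ 6 * (m * n)
  sixty-four = solve-∀
  reorder : ∀ a x y z → a * (x * y * z) ≡ x * a * y * z
  reorder = solve-∀

-- The theorem: take a dense core H of G (e(H) ≥ e/2), extend paths in H with x = e and q = 8m,
-- resp. 8n, i.e. at least d_A/8 and d_B/8 choices per step, and compare with G ⊇ H.
lemma4p3 : (p : ℕ) → .{{_ : NonZero p}} → (m n : ℕ) → .{{_ : NonZero m}} → .{{_ : NonZero n}} →
           (G : BipGraph m n) →
           8 * p * m ≤ edges G → 8 * p * n ≤ edges G →
           edges G * (edges G * edges G) ^ p ≤ 2 ^ (6 * p + 1) * (m * n) ^ p * numPaths G p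
lemma4p3 p m n G denseA denseB = begin
  e * (e * e) ^ p                              ≤⟨ *-monoˡ-≤ ((e * e) ^ p) half ⟩
  2 * edges H * (e * e) ^ p                    ≡⟨ *-assoc 2 (edges H) _ ⟩
  2 * (edges H * (e * e) ^ p)                  ≤⟨ *-monoʳ-≤ 2 (many-paths p ≤-refl) ⟩
  2 * ((8 * m * (8 * n)) ^ p * numPaths H p)   ≤⟨ *-monoʳ-≤ 2 (*-monoʳ-≤ ((8 * m * (8 * n)) ^ p) (numPaths-mono H⊆G p)) ⟩
  2 * ((8 * m * (8 * n)) ^ p * numPaths G p)   ≡⟨ constant p m n (numPaths G p) ⟩
  2 ^ (6 * p + 1) * (m * n) ^ p * numPaths G p ∎
  where
  open ≤-Reasoning
  e = edges G
  open Core (Cleaning.core G)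
  open Extension H p e (8 * m) e (8 * n)
    (λ a b h → margin m denseA (highA a b h)) (λ a b h → margin n denseB (highB a b h))
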